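{- Let $\Phi$ be a logic program and $A_1,\dots,A_n$ atomic formulas. If $\Phi \vdash \{A_1,\dots,A_n\} \leadsto^*_{\gamma} \emptyset$, then, given axioms $\Phi$, there exist proof terms $e_1,\dots,e_n$ with $e_1 : \forall \underline{x}.\ \Rightarrow \gamma A_1,\ \dots,\ e_n : \forall \underline{x}.\ \Rightarrow \gamma A_n$ derivable in the Horn-formulas-as-types system.
   Context: First-order terms $t ::= x \mid f(t_1,\dots,t_n)$ (function symbols of arity $0$ are constants); atomic formulas $A ::= P(t_1,\dots,t_n)$; Horn formulas $F ::= [\forall \underline{x}].\ A_1,\dots,A_n \Rightarrow A$ with $n\ge 0$ (for $n=0$ written $\Rightarrow A$), where $\forall\underline{x}.F$ quantifies all free term variables of $F$ and $[\forall\underline{x}].F$ means either $F$ or $\forall\underline{x}.F$. Proof terms $p,e ::= \kappa \mid a \mid \lambda a.e \mid e\ e'$ ($\kappa$ ranges over proof-term constants, $a$ over proof-term variables). A logic program (set of axioms) $\Phi$ is a list $\kappa_1 : F_1,\dots,\kappa_k:F_k$ of distinct constants labelling closed Horn formulas $\forall\underline{x}. B_1,\dots,B_m\Rightarrow C$. The typing judgement $e:F$ (given $\Phi$) is generated by the rules: (axiom) $\kappa:\forall\underline{x}.F$ if $(\kappa:\forall\underline{x}.F)\in\Phi$; (gen) from $e:F$ infer $e:\forall\underline{x}.F$; (inst) from $e:\forall\underline{x}.F$ infer $e:[\underline{t}/\underline{x}]F$; (cut) from $e_1:\underline{A}\Rightarrow D$ and $e_2:\underline{B},D\Rightarrow C$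 infer $\lambda\underline{a}.\lambda\underline{b}.(e_2\ \underline{b})\ (e_1\ \underline{a}) : \underline{A},\underline{B}\Rightarrow C$, where $\underline{a},\underline{b}$ are lists of proof-term variables of the lengths of $\underline{A},\underline{B}$, not free in $e_1,e_2$, $\lambda\underline{a}.t$ abbreviates $\lambda a_1.\cdots\lambda a_n.t$ and $t\ \underline{b}$ abbreviates $(\dots(t\ b_1)\dots b_n)$. We write $A\sim_\gamma A'$ if $\gamma$ is a (most general, idempotent) unifier of $A,A'$, i.e. $\gamma A\equiv\gamma A'$. LP-Unif reduction on multisets of atomic formulas: $\Phi\vdash\{A_1,\dots,A_i,\dots,A_n\}\leadsto_{\kappa,\gamma\cdot\gamma'}\{\gamma A_1,\dots,\gamma B_1,\dots,\gamma B_m,\dots,\gamma A_n\}$ (for any current state substitution $\gamma'$) whenever there is $\kappa:\forall\underline{x}.B_1,\dots,B_m\Rightarrow C\in\Phi$ (with its quantified variables renamed apart) such that $C\sim_\gamma A_i$. $\leadsto^*$ is the reflexive–transitive closure, and $\leadsto^*_\gamma$ denotes such a reduction sequence (starting from the empty substitution as state) whose final accumulated state is $\gamma$. $\forall\underline{x}.\ \Rightarrow \gamma A$ denotes the universal closure of $\Rightarrow\gamma A$. -}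

module Defs where

open import Data.Nat using (ℕ; _≟_)
open import Data.List using (List; []; _∷_; _++_; map; length; [_]; concatMap)
open import Data.List.Membership.Propositional using (_∈_; _∉_)
open import Data.List.Relation.Unary.All using (All)
open import Data.List.Relation.Unary.Unique.Propositional using (Unique)
open import Data.Product using (_×_; _,_; ∃; proj₁)
open import Relation.Nullary using (yes; no)
open import Relation.Binary.PropositionalEquality using (_≡_)
open import Relation.Binary.Construct.Closure.ReflexiveTransitive using (Star)
open import Function.Definitions using (Injective)

data Term : Set where
  var : ℕ → Term
  fn  : ℕ → List Term → Term   -- f(t1,...,tn); n = 0 gives a constant

record Atom : Set where
  constructor pred
  field
    psym : ℕ
    args : List Term
open Atom public

Subst : Set
Subst = ℕ → Term

mutual
  sub : Subst → Term → Term
  sub σ (var x)   = σ x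
  sub σ (fn f ts) = fn f (subs σ ts)

  subs : Subst → List Term → List Term
  subs σ []       = []
  subs σ (t ∷ ts) = sub σ t ∷ subs σ ts

subA : Subst → Atom → Atom
subA σ (pred P ts) = pred P (subs σ ts)

subAs : Subst → List Atom → List Atom
subAs σ = map (subA σ)

idS : Subst
idS = var

_∘ₛ_ : Subst → Subst → Subst
(γ ∘ₛ γ') x = sub γ (γ' x)

ren : (ℕ → ℕ) → Subst
ren ρ x = var (ρ x)

mutual
  varsT : Term → List ℕ
  varsT (var x)   = x ∷ []
  varsT (fn f ts) = varsTs ts

  varsTs : List Term → List ℕ
  varsTs []       = []
  varsTs (t ∷ ts) = varsT t ++ varsTs ts

varsA : Atom → List ℕ
varsA (pred P ts) = varsTs ts

varsAs : List Atom → List ℕ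
varsAs = concatMap varsA

-- Horn formulas.  A Horn formula is either  A1,...,An ⇒ A  (unquantified)
-- or its universal closure  ∀x. A1,...,An ⇒ A  (x = all free variables).

data Formula : Set where
  _⇒_   : List Atom → Atom → Formula
  ∀[_⇒_] : List Atom → Atom → Formula

record Clause : Set where
  constructor _⇐_
  field
    head : Atom
    body : List Atom
open Clause public

Program : Set
Program = List (ℕ × Clause)

LogicProgram : Program → Set
LogicProgram Φ = Unique (map proj₁ Φ)

data PT : Set where
  cst : ℕ → PT
  pv  : ℕ → PT
  ƛ   : ℕ → PT → PT
  _·_ : PT → PT → PT

remove : ℕ → List ℕ → List ℕ
remove x [] = []
remove x (y ∷ ys) with x ≟ y
... | yes _ = remove x ys
... | no  _ = y ∷ remove x ys

fv : PT → List ℕ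
fv (cst k) = []
fv (pv a)  = a ∷ []
fv (ƛ a e) = remove a (fv e)
fv (e · e') = fv e ++ fv e'

lams : List ℕ → PT → PT
lams []       t = t
lams (a ∷ as) t = ƛ a (lams as t)

apps : PT → List ℕ → PT
apps t []       = t
apps t (b ∷ bs) = apps (t · pv b) bs

data _⊢_∶_ (Φ : Program) : PT → Formula → Set where
  axiom : ∀ {k c} → (k , c) ∈ Φ → Φ ⊢ cst k ∶ ∀[ body c ⇒ head c ]
  gen   : ∀ {e As C} → Φ ⊢ e ∶ (As ⇒ C) → Φ ⊢ e ∶ ∀[ As ⇒ C ]
  inst  : ∀ {e As C} (σ : Subst) → Φ ⊢ e ∶ ∀[ As ⇒ C ] →
          Φ ⊢ e ∶ (subAs σ As ⇒ subA σ C)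
  cut   : ∀ {e₁ e₂ As Bs C D} (as bs : List ℕ) →
          length as ≡ length As → length bs ≡ length Bs →
          Unique (as ++ bs) →
          All (λ v → v ∉ fv e₁ × v ∉ fv e₂) (as ++ bs) →
          Φ ⊢ e₁ ∶ (As ⇒ D) → Φ ⊢ e₂ ∶ ((Bs ++ [ D ]) ⇒ C) →
          Φ ⊢ lams as (lams bs (apps e₂ bs · apps e₁ as)) ∶ ((As ++ Bs) ⇒ C)

record MGU (γ : Subst) (A A' : Atom) : Set where
  field
    unifies    : subA γ A ≡ subA γ A'
    idempotent : ∀ x → sub γ (γ x) ≡ γ x
    mostGen    : ∀ (δ : Subst) → subA δ A ≡ subA δ A' →
                 ∃ λ (θ : Subst) → ∀ x → δ x ≡ sub θ (γ x)

-- LP-Unif reduction.  States are (goal multiset, accumulated substitution);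
-- the multiset is a list, and any element A_i may be selected.

State : Set
State = List Atom × Subst

data Step (Φ : Program) : State → State → Set where
  step : ∀ {L A R γ' k c γ} (ρ : ℕ → ℕ) →
         Injective _≡_ _≡_ ρ →
         (k , c) ∈ Φ →
         All (λ v → v ∉ varsAs (L ++ A ∷ R))
             (varsAs (subA (ren ρ) (head c) ∷ subAs (ren ρ) (body c))) →
         MGU γ (subA (ren ρ) (head c)) A →
         Step Φ (L ++ A ∷ R , γ')
                (subAs γ (L ++ subAs (ren ρ) (body c) ++ R) , γ ∘ₛ γ')

_⊢_⇝*[_]∅ : Program → List Atom → Subst → Set
Φ ⊢ As ⇝*[ γ ]∅ = Star (Step Φ) (As , idS) ([] , γ)

-- Soundness of LP-Unif by induction on the reduction: if the last goals,
-- instantiated by some δ, are all provable, then so are the goals one step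
-- earlier, instantiated by δ ∘ γ for the unifier γ of that step.  The selected
-- goal γA equals the instance γ(ρC) of the clause head, so it is proved by
-- instantiating the axiom κ and cutting away its body atoms one at a time.
module Submission where

open import Defs
open import Data.List using (List; []; _∷_; _++_; _∷ʳ_; length; applyUpTo)
open import Data.List.Extrema.Nat using (max; xs≤max)
open import Data.List.Membership.Propositional using (_∈_; _∉_)
open import Data.List.Membership.Propositional.Properties
  using (∈-applyUpTo⁻; ∈-++⁺ˡ; ∈-++⁺ʳ)
open import Data.List.Properties using (length-applyUpTo)
open import Data.List.Relation.Unary.All as All using (All; []; _∷_; lookup)
open import Data.List.Relation.Unary.All.Properties using (++⁺; ++⁻ˡ; ++⁻ʳ; map⁺; map⁻)
open import Data.List.Relation.Unary.Unique.Propositional using (Unique)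
open import Data.List.Relation.Unary.Unique.Propositional.Properties using (applyUpTo⁺₁)
open import Data.List.Reverse using (Reverse; []; _∶_∶ʳ_; reverseView)
open import Data.Nat using (ℕ; suc; _+_)
open import Data.Nat.Properties using (<⇒≢; +-monoʳ-<; m≤m+n; <-irrefl; ≤-trans)
open import Data.Product using (∃; _×_; _,_)
open import Function using (_∘_)
open import Relation.Binary.Construct.Closure.ReflexiveTransitive using (Star; ε; _◅_)
open import Relation.Binary.PropositionalEquality
  using (_≡_; _≗_; refl; sym; trans; cong; cong₂; subst; module ≡-Reasoning)

mutual
  sub-cong : ∀ {σ τ : Subst} → σ ≗ τ → sub σ ≗ sub τ
  sub-cong σ≗τ (var x)   = σ≗τ x
  sub-cong σ≗τ (fn f ts) = cong (fn f) (subs-cong σ≗τ ts)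

  subs-cong : ∀ {σ τ : Subst} → σ ≗ τ → subs σ ≗ subs τ
  subs-cong σ≗τ []       = refl
  subs-cong σ≗τ (t ∷ ts) = cong₂ _∷_ (sub-cong σ≗τ t) (subs-cong σ≗τ ts)

mutual
  sub-∘ₛ : ∀ (σ τ : Subst) → sub (σ ∘ₛ τ) ≗ sub σ ∘ sub τ
  sub-∘ₛ σ τ (var x)   = refl
  sub-∘ₛ σ τ (fn f ts) = cong (fn f) (subs-∘ₛ σ τ ts)

  subs-∘ₛ : ∀ (σ τ : Subst) → subs (σ ∘ₛ τ) ≗ subs σ ∘ subs τ
  subs-∘ₛ σ τ []       = refl
  subs-∘ₛ σ τ (t ∷ ts) = cong₂ _∷_ (sub-∘ₛ σ τ t) (subs-∘ₛ σ τ ts)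

mutual
  sub-idS : sub idS ≗ (λ t → t)
  sub-idS (var x)   = refl
  sub-idS (fn f ts) = cong (fn f) (subs-idS ts)

  subs-idS : subs idS ≗ (λ ts → ts)
  subs-idS []       = refl
  subs-idS (t ∷ ts) = cong₂ _∷_ (sub-idS t) (subs-idS ts)

subA-cong : ∀ {σ τ : Subst} → σ ≗ τ → subA σ ≗ subA τ
subA-cong σ≗τ (pred P ts) = cong (pred P) (subs-cong σ≗τ ts)

subA-∘ₛ : ∀ (σ τ : Subst) → subA (σ ∘ₛ τ) ≗ subA σ ∘ subA τ
subA-∘ₛ σ τ (pred P ts) = cong (pred P) (subs-∘ₛ σ τ ts)

freshVars : List ℕ → ℕ → List ℕ
freshVars xs = applyUpTo (suc (max 0 xs) +_)

length-freshVars : ∀ xs k → length (freshVars xs k) ≡ k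
length-freshVars xs = length-applyUpTo _

freshVars-unique : ∀ xs k → Unique (freshVars xs k)
freshVars-unique xs k = applyUpTo⁺₁ _ k (λ i<j _ → <⇒≢ (+-monoʳ-< (suc (max 0 xs)) i<j))

freshVars-∉ : ∀ xs k → All (_∉ xs) (freshVars xs k)
freshVars-∉ xs k = All.tabulate fresh
  where
  fresh : ∀ {v} → v ∈ freshVars xs k → v ∉ xs
  fresh v∈ v∈xs with i , _ , refl ← ∈-applyUpTo⁻ _ v∈ =
    <-irrefl refl (≤-trans (m≤m+n (suc (max 0 xs)) i) (lookup (xs≤max 0 xs) v∈xs))

Fact : Program → Atom → Set
Fact Φ A = ∃ λ (e : PT) → Φ ⊢ e ∶ ([] ⇒ A)

cut-last : ∀ {Φ Bs C D e} → Fact Φ D → Φ ⊢ e ∶ ((Bs ∷ʳ D) ⇒ C) →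
           ∃ λ (e′ : PT) → Φ ⊢ e′ ∶ (Bs ⇒ C)
cut-last {Bs = Bs} {e = e₂} (e₁ , ⊢e₁) ⊢e₂ =
  _ , cut [] (freshVars used n) refl (length-freshVars used n) (freshVars-unique used n)
          (All.map (λ v∉ → v∉ ∘ ∈-++⁺ˡ , v∉ ∘ ∈-++⁺ʳ (fv e₁)) (freshVars-∉ used n))
          ⊢e₁ ⊢e₂
  where
  used = fv e₁ ++ fv e₂
  n    = length Bs

discharge : ∀ {Φ Bs C e} → Φ ⊢ e ∶ (Bs ⇒ C) → All (Fact Φ) Bs → Fact Φ C
discharge {Bs = Bs} = go (reverseView Bs)
  where
  go : ∀ {Φ Bs C e} → Reverse Bs → Φ ⊢ e ∶ (Bs ⇒ C) → All (Fact Φ) Bs → Fact Φ C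
  go []                ⊢e []    = _ , ⊢e
  go (Bs ∶ view ∶ʳ D) ⊢e facts with ++⁻ʳ Bs facts
  ... | fact-D ∷ [] with _ , ⊢e′ ← cut-last fact-D ⊢e = go view ⊢e′ (++⁻ˡ Bs facts)

All-Fact-subAs : ∀ {Φ} δ τ {As} → All (Fact Φ ∘ subA δ) (subAs τ As) →
                 All (Fact Φ ∘ subA (δ ∘ₛ τ)) As
All-Fact-subAs δ τ = All.map (λ {A} → subst (Fact _) (sym (subA-∘ₛ δ τ A))) ∘ map⁻

Solution : Program → List Atom → Subst → Subst → Set
Solution Φ As γ₀ γ =
  ∃ λ (δ : Subst) → γ ≗ δ ∘ₛ γ₀ × All (Fact Φ ∘ subA δ) As

step-sound : ∀ {Φ As Bs γ₀ γ₁ γ} → Step Φ (As , γ₀) (Bs , γ₁) →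
             Solution Φ Bs γ₁ γ → Solution Φ As γ₀ γ
step-sound {Φ} {γ₀ = γ₀}
  (step {L = L} {A} {R} {c = c} {γ = g} ρ _ κ∈Φ _ mgu) (δ , γ≗ , facts) =
  δ ∘ₛ g , (λ x → trans (γ≗ x) (sym (sub-∘ₛ δ g (γ₀ x)))) , ++⁺ facts-L (fact-A ∷ facts-R)
  where
  θ = δ ∘ₛ g
  Bsρ = subAs (ren ρ) (body c)

  facts-LBR : All (Fact Φ ∘ subA θ) (L ++ Bsρ ++ R)
  facts-LBR = All-Fact-subAs δ g facts

  facts-L : All (Fact Φ ∘ subA θ) L
  facts-L = ++⁻ˡ L facts-LBR

  facts-R : All (Fact Φ ∘ subA θ) R
  facts-R = ++⁻ʳ Bsρ (++⁻ʳ L facts-LBR)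

  facts-body : All (Fact Φ ∘ subA (θ ∘ₛ ren ρ)) (body c)
  facts-body = All-Fact-subAs θ (ren ρ) (++⁻ˡ Bsρ (++⁻ʳ L facts-LBR))

  head≡A : subA (θ ∘ₛ ren ρ) (head c) ≡ subA θ A
  head≡A = begin
    subA (θ ∘ₛ ren ρ) (head c)              ≡⟨ subA-∘ₛ θ (ren ρ) (head c) ⟩
    subA θ (subA (ren ρ) (head c))          ≡⟨ subA-∘ₛ δ g _ ⟩
    subA δ (subA g (subA (ren ρ) (head c))) ≡⟨ cong (subA δ) (MGU.unifies mgu) ⟩
    subA δ (subA g A)                       ≡⟨ sym (subA-∘ₛ δ g A) ⟩
    subA θ A                                ∎
    where open ≡-Reasoning

  fact-A : Fact Φ (subA θ A)
  fact-A = subst (Fact Φ) head≡A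
    (discharge (inst (θ ∘ₛ ren ρ) (axiom κ∈Φ)) (map⁺ facts-body))

reduction-sound : ∀ {Φ As γ₀ γ} → Star (Step Φ) (As , γ₀) ([] , γ) → Solution Φ As γ₀ γ
reduction-sound ε          = idS , (λ x → sym (sub-idS _)) , []
reduction-sound (s ◅ rest) = step-sound s (reduction-sound rest)

lemma1 : (Φ : Program) → LogicProgram Φ → (As : List Atom) (γ : Subst) →
    Φ ⊢ As ⇝*[ γ ]∅ →
    All (λ A → ∃ λ (e : PT) → Φ ⊢ e ∶ ∀[ [] ⇒ subA γ A ]) As
lemma1 Φ _ As γ reduction with δ , γ≗δ , facts ← reduction-sound reduction =
  All.map (λ {A} (e , ⊢e) → e , gen (subst (λ B → Φ ⊢ e ∶ ([] ⇒ B)) (sym (subA-cong γ≗δ A)) ⊢e))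
          facts
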